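{- Let $X$ be a finite set with $n\ge1$ elements, let $\mathcal{F}$ be a union-closed family of subsets of $X$ with $\bigcup_{f\in\mathcal{F}}f=X$, and let $g\in\mathcal{F}$. Then the set $\{\varphi_u(g): u \text{ a word listing the elements of } X\}$ is equal to $\max(\mathrm{Fib}(g))$.
   Context: Union-closed: $f,g\in\mathcal{F}\Rightarrow f\cup g\in\mathcal{F}$. $\min(\mathcal{F})$ is the set of inclusion-minimal members of $\mathcal{F}$ and $\min(\mathcal{F})^{\uparrow}=\{z\subseteq X:\exists h\in\min(\mathcal{F}),\ h\subseteq z\}$. For $z\in\min(\mathcal{F})^{\uparrow}$ put $z^*=\bigcup_{\{h\in\mathcal{F}:h\subseteq z\}}h\in\mathcal{F}$, and for $g\in\mathcal{F}$ let $\mathrm{Fib}(g)=\{z\in\min(\mathcal{F})^{\uparrow}: z^*=g\}$; $\max(\mathrm{Fib}(g))$ is its set of inclusion-maximal elements. Rising functions: for $T\subseteq 2^X$ and $a\in X$, $\varphi_{T,a}(z)=z\cup\{a\}$ if $z\cup\{a\}\notin T$, and $\varphi_{T,a}(z)=z$ otherwise. For a word $u=b_1\cdots b_n$ (an ordering of all elements of $X$), set $\varphi_0=\mathrm{id}$, $\mathcal{F}_0=\mathcal{F}$, $\varphi_j=\varphi_{\mathcal{F}_{j-1},b_j}\circ\varphi_{j-1}$, $\mathcal{F}_j=\varphi_j(\mathcal{F})$, and $\varphi_u=\varphi_n$. -}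

module Defs where

open import Data.Nat using (ℕ)
open import Data.Bool using (Bool; if_then_else_)
import Data.Bool.Properties as BoolP
open import Data.Fin using (Fin)
open import Data.Fin.Subset using (Subset; _∪_; ⁅_⁆; _⊆_; _∈_; ⋃; ⊥)
open import Data.Fin.Subset.Properties using (_⊆?_)
open import Data.List using (List; []; _∷_; map; filter)
import Data.List.Membership.Propositional as LMem
import Data.List.Membership.DecPropositional as DecMem
open import Data.Vec.Properties using (≡-dec)
open import Data.Product using (Σ; _×_; ∃; ∃-syntax)
open import Relation.Binary.PropositionalEquality using (_≡_)
open import Relation.Nullary using (does)
open import Function using (id; _∘_)

-- A family of subsets of X = Fin n, given as a finite list (duplicates irrelevant;
-- membership is list membership).
Family : ℕ → Set
Family n = List (Subset n)

module _ {n : ℕ} where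

  open DecMem (≡-dec {n = n} BoolP._≟_) using (_∈?_)

  _∈F_ : Subset n → Family n → Set
  z ∈F F = z LMem.∈ F

  UnionClosed : Family n → Set
  UnionClosed F = ∀ f g → f ∈F F → g ∈F F → (f ∪ g) ∈F F

  Covers : Family n → Set
  Covers F = ∀ (x : Fin n) → ∃[ f ] (f ∈F F × x ∈ f)

  IsMin : Family n → Subset n → Set
  IsMin F h = h ∈F F × (∀ f → f ∈F F → f ⊆ h → f ≡ h)

  InMinUp : Family n → Subset n → Set
  InMinUp F z = ∃[ h ] (IsMin F h × h ⊆ z)

  star : Family n → Subset n → Subset n
  star F z = ⋃ (filter (_⊆? z) F)

  InFib : Family n → Subset n → Subset n → Set
  InFib F g z = InMinUp F z × star F z ≡ g

  InMaxFib : Family n → Subset n → Subset n → Set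
  InMaxFib F g z = InFib F g z × (∀ w → InFib F g w → z ⊆ w → w ≡ z)

  rise : Family n → Fin n → Subset n → Subset n
  rise T a z = if does ((z ∪ ⁅ a ⁆) ∈? T) then z else (z ∪ ⁅ a ⁆)

  -- φ for a word, carrying the current family F_{j-1}:
  -- phiAux T (b ∷ bs) = phiAux (φ_{T,b}(T)) bs ∘ φ_{T,b}
  phiAux : Family n → List (Fin n) → Subset n → Subset n
  phiAux T []       = id
  phiAux T (b ∷ bs) = phiAux (map (rise T b) T) bs ∘ rise T b

  phi : Family n → List (Fin n) → Subset n → Subset n
  phi F u = phiAux F u

module Submission where

-- The proof replaces the rising functions φ_u, which consult the moving family
-- F_{j-1}, by an intrinsic greedy process: starting from x, read the letters of
-- a word and add a letter c to the current set x exactly when this does not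
-- change its star, i.e. when (x ∪ {c})* = x*.

open import Defs
open import Data.Nat using (ℕ; _≤_)
open import Data.Fin using (Fin)
open import Data.Fin.Subset using (Subset; _∪_; ⁅_⁆; _⊆_; _∈_; ⋃)
open import Data.Fin.Subset.Properties
  using (_⊆?_; ⊆-antisym; ⊆-trans; p⊆p∪q; q⊆p∪q; x∈p∪q⁻; x∈⁅x⁆; x∈⁅y⁆⇒x≡y; ∉⊥; ∪-identityʳ; ∪-assoc; ∪-comm)
  renaming (_∈?_ to _∈ₛ?_)
open import Data.Bool using (if_then_else_)
import Data.Bool.Properties as BoolP
open import Data.Vec.Properties using (≡-dec)
open import Data.List using (List; []; _∷_; allFin; _++_; [_]; map; filter)
import Data.List.Membership.Propositional as LMem
open import Data.List.Membership.Propositional.Properties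
  using (∈-map⁺; ∈-map⁻; ∈-filter⁺; ∈-filter⁻; ∈-∃++; ∈-allFin)
import Data.List.Membership.DecPropositional as DecMem
open import Data.List.Relation.Unary.Any using (here; there)
open import Data.List.Relation.Unary.All as All using (All; []; _∷_)
open import Data.List.Relation.Unary.All.Properties using (All¬⇒¬Any; ++⁻ˡ; ++⁻ʳ)
open import Data.List.Relation.Unary.AllPairs using ([]; _∷_)
open import Data.List.Relation.Unary.Unique.Propositional using (Unique)
open import Data.List.Relation.Unary.Unique.Propositional.Properties using (allFin⁺)
open import Data.List.Relation.Binary.Permutation.Propositional using (_↭_; ↭-sym; ↭⇒↭ₛ)
import Data.List.Relation.Binary.Permutation.Propositional as Perm
open import Data.List.Relation.Binary.Permutation.Propositional.Properties using (∈-resp-↭; shift)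
import Data.List.Relation.Binary.Permutation.Setoid.Properties as PermSetoid
open import Data.List.Properties using (++-assoc; ++-identityʳ)
open import Data.Product using (_×_; ∃-syntax; _,_; proj₁; proj₂)
open import Data.Sum using (_⊎_; inj₁; inj₂)
open import Data.Empty using (⊥-elim)
open import Relation.Binary.PropositionalEquality
  using (_≡_; _≢_; refl; sym; trans; cong; subst; setoid; module ≡-Reasoning)
open import Relation.Nullary using (Dec; does; yes; no; ¬_; ¬?)
open import Relation.Unary using (Pred; Decidable)
open import Function using (id; _∘_)
open import Function.Bundles using (_⇔_; mk⇔)

⋃-upper : ∀ {n} {xs : List (Subset n)} {x} → x LMem.∈ xs → x ⊆ ⋃ xs
⋃-upper {xs = y ∷ ys} (here refl) = p⊆p∪q (⋃ ys)
⋃-upper {xs = y ∷ ys} (there x∈ys) = ⊆-trans (⋃-upper x∈ys) (q⊆p∪q y (⋃ ys))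

⋃-least : ∀ {n} {xs : List (Subset n)} {w} → (∀ {x} → x LMem.∈ xs → x ⊆ w) → ⋃ xs ⊆ w
⋃-least {xs = []} _ a∈⊥ = ⊥-elim (∉⊥ a∈⊥)
⋃-least {xs = y ∷ ys} bound a∈ with x∈p∪q⁻ y (⋃ ys) a∈
... | inj₁ a∈y = bound (here refl) a∈y
... | inj₂ a∈⋃ys = ⋃-least (bound ∘ there) a∈⋃ys

∪-least : ∀ {n} {a b w : Subset n} → a ⊆ w → b ⊆ w → a ∪ b ⊆ w
∪-least {a = a} {b} a⊆w b⊆w x∈ with x∈p∪q⁻ a b x∈
... | inj₁ x∈a = a⊆w x∈a
... | inj₂ x∈b = b⊆w x∈b

⁅⁆-⊆ : ∀ {n} {c : Fin n} {w} → c ∈ w → ⁅ c ⁆ ⊆ w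
⁅⁆-⊆ {c = c} {w} c∈w x∈ = subst (_∈ w) (sym (x∈⁅y⁆⇒x≡y c x∈)) c∈w

∈-∪⁅⁆ : ∀ {n} (x : Subset n) (c : Fin n) → c ∈ x ∪ ⁅ c ⁆
∈-∪⁅⁆ x c = q⊆p∪q x ⁅ c ⁆ (x∈⁅x⁆ c)

∈-∪⁅⁆⁻ : ∀ {n} {x : Subset n} {b c} → c ∈ x ∪ ⁅ b ⁆ → c ≢ b → c ∈ x
∈-∪⁅⁆⁻ {x = x} {b} c∈ c≢b with x∈p∪q⁻ x ⁅ b ⁆ c∈
... | inj₁ c∈x = c∈x
... | inj₂ c∈b = ⊥-elim (c≢b (x∈⁅y⁆⇒x≡y b c∈b))

∪⁅⁆-absorb : ∀ {n} {c : Fin n} {x} → c ∈ x → x ∪ ⁅ c ⁆ ≡ x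
∪⁅⁆-absorb c∈x = ⊆-antisym (∪-least id (⁅⁆-⊆ c∈x)) (p⊆p∪q _)

∪-swapʳ : ∀ {n} (a b c : Subset n) → (a ∪ b) ∪ c ≡ (a ∪ c) ∪ b
∪-swapʳ a b c = trans (∪-assoc a b c) (trans (cong (a ∪_) (∪-comm b c)) (sym (∪-assoc a c b)))

_≟ₛ_ : ∀ {n} → (a b : Subset n) → Dec (a ≡ b)
_≟ₛ_ = ≡-dec BoolP._≟_

⋃-closed : ∀ {n} {F : Family n} → UnionClosed F → (xs : List (Subset n)) →
  (∀ {x} → x LMem.∈ xs → x ∈F F) → ∀ {y} → y LMem.∈ xs → ⋃ xs ∈F F
⋃-closed {F = F} _ (x ∷ []) members _ =
  subst (_∈F F) (sym (∪-identityʳ x)) (members (here refl))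
⋃-closed UC (x ∷ y ∷ ys) members _ =
  UC x (⋃ (y ∷ ys)) (members (here refl)) (⋃-closed UC (y ∷ ys) (members ∘ there) (here refl))

unique-split : ∀ {a} {A : Set a} (xs : List A) {y ys} →
  Unique (xs ++ y ∷ ys) → Unique xs × All (_≢ y) xs
unique-split [] _ = [] , []
unique-split (x ∷ xs) (x∉ ∷ u) with unique-split xs u
... | u′ , xs≢y = (++⁻ˡ xs x∉ ∷ u′) , (All.head (++⁻ʳ xs x∉) ∷ xs≢y)

unique-↭ : ∀ {a} {A : Set a} {xs ys : List A} → xs ↭ ys → Unique xs → Unique ys
unique-↭ {A = A} p = PermSetoid.Unique-resp-↭ (setoid A) (↭⇒↭ₛ p)

filter-split-↭ : ∀ {a p} {A : Set a} {P : Pred A p} (P? : Decidable P) (xs : List A) →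
  filter P? xs ++ filter (¬? ∘ P?) xs ↭ xs
filter-split-↭ P? [] = Perm.refl
filter-split-↭ P? (x ∷ xs) with P? x
... | yes _ = Perm.prep x (filter-split-↭ P? xs)
... | no _ = Perm.trans (shift x (filter P? xs) (filter (¬? ∘ P?) xs)) (Perm.prep x (filter-split-↭ P? xs))

module _ {n : ℕ} where

  open DecMem (≡-dec {n = n} BoolP._≟_) using (_∈?_)

  rise-blocked : ∀ {T b z} → (z ∪ ⁅ b ⁆) ∈F T → rise T b z ≡ z
  rise-blocked {T} {b} {z} z∪b∈T with (z ∪ ⁅ b ⁆) ∈? T
  ... | yes _ = refl
  ... | no z∪b∉T = ⊥-elim (z∪b∉T z∪b∈T)

  rise-free : ∀ {T b z} → ¬ (z ∪ ⁅ b ⁆) ∈F T → rise T b z ≡ z ∪ ⁅ b ⁆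
  rise-free {T} {b} {z} z∪b∉T with (z ∪ ⁅ b ⁆) ∈? T
  ... | yes z∪b∈T = ⊥-elim (z∪b∉T z∪b∈T)
  ... | no _ = refl

module Closure {n : ℕ} (F : Family n) where

  below : Subset n → Family n
  below w = filter (_⊆? w) F

  below⁻ : ∀ {h w} → h ∈F below w → h ∈F F × h ⊆ w
  below⁻ {w = w} = ∈-filter⁻ (_⊆? w) {xs = F}

  star-⊆ : ∀ w → star F w ⊆ w
  star-⊆ w = ⋃-least (proj₂ ∘ below⁻)

  ⊆-star : ∀ {h w} → h ∈F F → h ⊆ w → h ⊆ star F w
  ⊆-star {w = w} h∈F h⊆w = ⋃-upper (∈-filter⁺ (_⊆? w) h∈F h⊆w)

  star-mono : ∀ {w w′} → w ⊆ w′ → star F w ⊆ star F w′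
  star-mono w⊆w′ = ⋃-least λ h∈ → let (h∈F , h⊆w) = below⁻ h∈ in ⊆-star h∈F (⊆-trans h⊆w w⊆w′)

  star-fixes : ∀ {f} → f ∈F F → star F f ≡ f
  star-fixes f∈F = ⊆-antisym (star-⊆ _) (⊆-star f∈F id)

  star-∈F : UnionClosed F → ∀ {h w} → h ∈F F → h ⊆ w → star F w ∈F F
  star-∈F UC {w = w} h∈F h⊆w =
    ⋃-closed UC (below w) (proj₁ ∘ below⁻) (∈-filter⁺ (_⊆? w) h∈F h⊆w)

  star-squeeze : ∀ {x y w} → x ⊆ y → y ⊆ w → star F x ≡ star F w → star F y ≡ star F x
  star-squeeze x⊆y y⊆w same =
    ⊆-antisym (λ a∈ → subst (_ ∈_) (sym same) (star-mono y⊆w a∈)) (star-mono x⊆y)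

  star-between : ∀ {f y w} → f ∈F F → f ⊆ y → y ⊆ w → star F w ≡ f → star F y ≡ f
  star-between f∈F f⊆y y⊆w w*≡f =
    trans (star-squeeze f⊆y y⊆w (trans (star-fixes f∈F) (sym w*≡f))) (star-fixes f∈F)

  -- If adding c changes the star, then c belongs to the new star: otherwise every
  -- member below w ∪ {c} already lies below w.
  star-new-point : ∀ w c → star F (w ∪ ⁅ c ⁆) ≢ star F w → c ∈ star F (w ∪ ⁅ c ⁆)
  star-new-point w c changed with c ∈ₛ? star F (w ∪ ⁅ c ⁆)
  ... | yes c∈ = c∈
  ... | no c∉ = ⊥-elim (changed (⊆-antisym shrink (star-mono (p⊆p∪q _))))
    where
      avoid : ∀ {h} → h ∈F F → h ⊆ w ∪ ⁅ c ⁆ → h ⊆ w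
      avoid h∈F h⊆ x∈h = ∈-∪⁅⁆⁻ (h⊆ x∈h) λ { refl → c∉ (⊆-star h∈F h⊆ x∈h) }
      shrink : star F (w ∪ ⁅ c ⁆) ⊆ star F w
      shrink = ⋃-least λ h∈ → let (h∈F , h⊆) = below⁻ h∈ in ⊆-star h∈F (avoid h∈F h⊆)

  greedyStep : Fin n → Subset n → Subset n
  greedyStep c x = if does (star F (x ∪ ⁅ c ⁆) ≟ₛ star F x) then x ∪ ⁅ c ⁆ else x

  step-adds : ∀ {c x} → star F (x ∪ ⁅ c ⁆) ≡ star F x → greedyStep c x ≡ x ∪ ⁅ c ⁆
  step-adds {c} {x} same with star F (x ∪ ⁅ c ⁆) ≟ₛ star F x
  ... | yes _ = refl
  ... | no changed = ⊥-elim (changed same)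

  step-skips : ∀ {c x} → star F (x ∪ ⁅ c ⁆) ≢ star F x → greedyStep c x ≡ x
  step-skips {c} {x} changed with star F (x ∪ ⁅ c ⁆) ≟ₛ star F x
  ... | yes same = ⊥-elim (changed same)
  ... | no _ = refl

  step-star : ∀ c x → star F (greedyStep c x) ≡ star F x
  step-star c x with star F (x ∪ ⁅ c ⁆) ≟ₛ star F x
  ... | yes same = same
  ... | no _ = refl

  step-⊇ : ∀ c x → x ⊆ greedyStep c x
  step-⊇ c x with star F (x ∪ ⁅ c ⁆) ≟ₛ star F x
  ... | yes _ = p⊆p∪q _
  ... | no _ = id

  step-⊆ : ∀ c x → greedyStep c x ⊆ x ∪ ⁅ c ⁆
  step-⊆ c x with star F (x ∪ ⁅ c ⁆) ≟ₛ star F x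
  ... | yes _ = id
  ... | no _ = p⊆p∪q _

  step-absorbs : ∀ {c x w} → x ⊆ w → c ∈ w → star F x ≡ star F w → c ∈ greedyStep c x
  step-absorbs {c} {x} x⊆w c∈w same =
    subst (c ∈_) (sym (step-adds (star-squeeze (p⊆p∪q _) (∪-least x⊆w (⁅⁆-⊆ c∈w)) same))) (∈-∪⁅⁆ x c)

  greedy : Subset n → List (Fin n) → Subset n
  greedy x [] = x
  greedy x (c ∷ cs) = greedy (greedyStep c x) cs

  greedy-star : ∀ x L → star F (greedy x L) ≡ star F x
  greedy-star x [] = refl
  greedy-star x (c ∷ L) = trans (greedy-star (greedyStep c x) L) (step-star c x)

  greedy-⊇ : ∀ x L → x ⊆ greedy x L
  greedy-⊇ x [] = id
  greedy-⊇ x (c ∷ L) = ⊆-trans (step-⊇ c x) (greedy-⊇ (greedyStep c x) L)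

  greedy-++ : ∀ x L M → greedy x (L ++ M) ≡ greedy (greedy x L) M
  greedy-++ x [] M = refl
  greedy-++ x (c ∷ L) M = greedy-++ (greedyStep c x) L M

  greedy-⊆ : ∀ {w} x L → x ⊆ w → All (_∈ w) L → greedy x L ⊆ w
  greedy-⊆ x [] x⊆w [] = x⊆w
  greedy-⊆ x (c ∷ L) x⊆w (c∈w ∷ L⊆w) =
    greedy-⊆ (greedyStep c x) L (⊆-trans (step-⊆ c x) (∪-least x⊆w (⁅⁆-⊆ c∈w))) L⊆w

  greedy-letters : ∀ {c} x L → c ∈ greedy x L → c ∈ x ⊎ c LMem.∈ L
  greedy-letters x [] c∈ = inj₁ c∈
  greedy-letters {c} x (d ∷ L) c∈ with greedy-letters (greedyStep d x) L c∈
  ... | inj₂ c∈L = inj₂ (there c∈L)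
  ... | inj₁ c∈step with x∈p∪q⁻ x ⁅ d ⁆ (step-⊆ d x c∈step)
  ...   | inj₁ c∈x = inj₁ c∈x
  ...   | inj₂ c∈d = inj₂ (here (x∈⁅y⁆⇒x≡y d c∈d))

  greedy-collects : ∀ {x w c L} → x ⊆ w → star F x ≡ star F w → greedy x L ⊆ w →
    c LMem.∈ L → c ∈ w → c ∈ greedy x L
  greedy-collects {x} {w} {c} x⊆w same run⊆w c∈L c∈w with ∈-∃++ c∈L
  ... | ys , zs , refl = subst (c ∈_) (sym split) (greedy-⊇ _ zs (step-absorbs x′⊆w c∈w x′-same))
    where
      x′ : Subset n
      x′ = greedy x ys
      split : greedy x (ys ++ c ∷ zs) ≡ greedy (greedyStep c x′) zs
      split = greedy-++ x ys (c ∷ zs)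
      x′⊆w : x′ ⊆ w
      x′⊆w = ⊆-trans (greedy-⊇ x′ (c ∷ zs)) (subst (_⊆ w) split run⊆w)
      x′-same : star F x′ ≡ star F w
      x′-same = trans (greedy-star x ys) same

  -- Every member g of F lies above a minimal member: scan F, moving to each
  -- member below the current candidate.
  scanMin : List (Subset n) → Subset n → Subset n
  scanMin [] m = m
  scanMin (f ∷ fs) m with f ⊆? m
  ... | yes _ = scanMin fs f
  ... | no _ = scanMin fs m

  scanMin-⊆ : ∀ fs m → scanMin fs m ⊆ m
  scanMin-⊆ [] m = id
  scanMin-⊆ (f ∷ fs) m with f ⊆? m
  ... | yes f⊆m = ⊆-trans (scanMin-⊆ fs f) f⊆m
  ... | no _ = scanMin-⊆ fs m

  scanMin-∈F : ∀ fs m → m ∈F F → (∀ {f} → f LMem.∈ fs → f ∈F F) → scanMin fs m ∈F F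
  scanMin-∈F [] m m∈F _ = m∈F
  scanMin-∈F (f ∷ fs) m m∈F fs⊆F with f ⊆? m
  ... | yes _ = scanMin-∈F fs f (fs⊆F (here refl)) (fs⊆F ∘ there)
  ... | no _ = scanMin-∈F fs m m∈F (fs⊆F ∘ there)

  scanMin-minimal : ∀ fs m {f} → f LMem.∈ fs → f ⊆ scanMin fs m → f ≡ scanMin fs m
  scanMin-minimal (f ∷ fs) m f∈ f⊆ with f ⊆? m
  scanMin-minimal (f ∷ fs) m (here refl) f⊆ | yes _ = ⊆-antisym f⊆ (scanMin-⊆ fs f)
  scanMin-minimal (f ∷ fs) m (there f∈) f⊆ | yes _ = scanMin-minimal fs f f∈ f⊆
  scanMin-minimal (f ∷ fs) m (here refl) f⊆ | no f⊈m = ⊥-elim (f⊈m (⊆-trans f⊆ (scanMin-⊆ fs m)))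
  scanMin-minimal (f ∷ fs) m (there f∈) f⊆ | no _ = scanMin-minimal fs m f∈ f⊆

  minUp : ∀ {g z} → g ∈F F → g ⊆ z → InMinUp F z
  minUp {g} g∈F g⊆z =
    scanMin F g , (scanMin-∈F F g g∈F id , λ f f∈F f⊆ → scanMin-minimal F g f∈F f⊆) ,
    ⊆-trans (scanMin-⊆ F g) g⊆z

  greedy-maxFib : ∀ {g u} → g ∈F F → (∀ a → a LMem.∈ u) → InMaxFib F g (greedy g u)
  greedy-maxFib {g} {u} g∈F complete = (minUp g∈F (greedy-⊇ g u) , fib) , maximal
    where
      fib : star F (greedy g u) ≡ g
      fib = trans (greedy-star g u) (star-fixes g∈F)
      maximal : ∀ w → InFib F g w → greedy g u ⊆ w → w ≡ greedy g u
      maximal w (_ , w*≡g) run⊆w = ⊆-antisym collect run⊆w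
        where
          g⊆w : g ⊆ w
          g⊆w = subst (_⊆ w) w*≡g (star-⊆ w)
          collect : w ⊆ greedy g u
          collect {a} a∈w =
            greedy-collects g⊆w (trans (star-fixes g∈F) (sym w*≡g)) run⊆w (complete a) a∈w

  maxFib-stable : ∀ {g z} → InMaxFib F g z → ∀ c → greedyStep c z ≡ z
  maxFib-stable {z = z} ((z-up , z*≡g) , maximal) c = decide (star F (z ∪ ⁅ c ⁆) ≟ₛ star F z)
    where
      up : InMinUp F (z ∪ ⁅ c ⁆)
      up = let (h , h-min , h⊆z) = z-up in h , h-min , ⊆-trans h⊆z (p⊆p∪q _)
      decide : Dec (star F (z ∪ ⁅ c ⁆) ≡ star F z) → greedyStep c z ≡ z
      decide (no changed) = step-skips changed
      decide (yes same) =
        trans (step-adds same) (maximal (z ∪ ⁅ c ⁆) (up , trans same z*≡g) (p⊆p∪q _))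

  greedy-stable : ∀ {z} → (∀ c → greedyStep c z ≡ z) → ∀ L → greedy z L ≡ z
  greedy-stable stable [] = refl
  greedy-stable stable (c ∷ L) = trans (cong (λ t → greedy t L) (stable c)) (greedy-stable stable L)

  lettersOf : Subset n → List (Fin n)
  lettersOf z = filter (_∈ₛ? z) (allFin n)

  maxFib-reached : ∀ {g z} → g ∈F F → InMaxFib F g z → ∀ rest → greedy g (lettersOf z ++ rest) ≡ z
  maxFib-reached {g} {z} g∈F zmax@((_ , z*≡g) , _) rest = begin
    greedy g (lettersOf z ++ rest)  ≡⟨ greedy-++ g (lettersOf z) rest ⟩
    greedy (greedy g (lettersOf z)) rest  ≡⟨ cong (λ t → greedy t rest) fill ⟩
    greedy z rest  ≡⟨ greedy-stable (maxFib-stable zmax) rest ⟩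
    z  ∎
    where
      open ≡-Reasoning
      g⊆z : g ⊆ z
      g⊆z = subst (_⊆ z) z*≡g (star-⊆ z)
      letters⊆z : All (_∈ z) (lettersOf z)
      letters⊆z = All.tabulate λ c∈ → proj₂ (∈-filter⁻ (_∈ₛ? z) {xs = allFin n} c∈)
      run⊆z : greedy g (lettersOf z) ⊆ z
      run⊆z = greedy-⊆ g (lettersOf z) g⊆z letters⊆z
      fill : greedy g (lettersOf z) ≡ z
      fill = ⊆-antisym run⊆z λ {c} c∈z →
        greedy-collects g⊆z (trans (star-fixes g∈F) (sym z*≡g)) run⊆z
          (∈-filter⁺ (_∈ₛ? z) (∈-allFin c) c∈z) c∈z

-- The rising functions agree with greedy runs (F union-closed).

module Rising {n : ℕ} (F : Family n) (UC : UnionClosed F) where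

  open Closure F

  Image : Family n → List (Fin n) → Set
  Image T pre = (∀ w → w ∈F T → ∃[ f ] (f ∈F F × w ≡ greedy f pre)) × (∀ f → f ∈F F → greedy f pre ∈F T)

  image-canonical : ∀ {T pre w} → Image T pre → w ∈F T → w ≡ greedy (star F w) pre
  image-canonical {pre = pre} {w} (runs , _) w∈T with runs w w∈T
  ... | f , f∈F , refl = cong (λ t → greedy t pre) (sym (trans (greedy-star f pre) (star-fixes f∈F)))

  -- Shift, one step: let f' = (z ∪ {b})* ∈ F and let the step from x at a letter
  -- c ≠ b stay inside z, taking c whenever c ∈ z.  Then the step from x ∪ f'
  -- makes the same choice, because every set between f' and z ∪ {b} has star f'.
  shift-step : ∀ {f′ z b c x} → f′ ∈F F → star F (z ∪ ⁅ b ⁆) ≡ f′ → c ≢ b →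
    greedyStep c x ⊆ z → (c ∈ z → c ∈ greedyStep c x) →
    greedyStep c (x ∪ f′) ≡ greedyStep c x ∪ f′
  shift-step {f′} {z} {b} {c} {x} f′∈F zb*≡f′ c≢b step⊆z took =
    decide (star F (x ∪ ⁅ c ⁆) ≟ₛ star F x)
    where
      open ≡-Reasoning
      f′⊆zb : f′ ⊆ z ∪ ⁅ b ⁆
      f′⊆zb = subst (_⊆ z ∪ ⁅ b ⁆) zb*≡f′ (star-⊆ _)
      y⊆zb : x ∪ f′ ⊆ z ∪ ⁅ b ⁆
      y⊆zb = ∪-least (⊆-trans (⊆-trans (step-⊇ c x) step⊆z) (p⊆p∪q _)) f′⊆zb
      y*≡f′ : star F (x ∪ f′) ≡ f′
      y*≡f′ = star-between f′∈F (q⊆p∪q x f′) y⊆zb zb*≡f′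
      decide : Dec (star F (x ∪ ⁅ c ⁆) ≡ star F x) → greedyStep c (x ∪ f′) ≡ greedyStep c x ∪ f′
      decide (yes same) = begin
        greedyStep c (x ∪ f′)  ≡⟨ step-adds (trans yc*≡f′ (sym y*≡f′)) ⟩
        (x ∪ f′) ∪ ⁅ c ⁆  ≡⟨ ∪-swapʳ x f′ ⁅ c ⁆ ⟩
        (x ∪ ⁅ c ⁆) ∪ f′  ≡⟨ cong (_∪ f′) (sym (step-adds same)) ⟩
        greedyStep c x ∪ f′  ∎
        where
          c∈z : c ∈ z
          c∈z = step⊆z (subst (c ∈_) (sym (step-adds same)) (∈-∪⁅⁆ x c))
          yc*≡f′ : star F ((x ∪ f′) ∪ ⁅ c ⁆) ≡ f′
          yc*≡f′ = star-between f′∈F (⊆-trans (q⊆p∪q x f′) (p⊆p∪q _))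
                     (∪-least y⊆zb (⁅⁆-⊆ (p⊆p∪q _ c∈z))) zb*≡f′
      decide (no changed) =
        trans (step-skips y-skips) (cong (_∪ f′) (sym (step-skips changed)))
        where
          -- If the step from x ∪ f' took c, then c ∈ (x ∪ {c})* ⊆ f' ⊆ z ∪ {b},
          -- so c ∈ z and the step from x would have taken c after all.
          y-skips : star F ((x ∪ f′) ∪ ⁅ c ⁆) ≢ star F (x ∪ f′)
          y-skips same′ = changed (cong (star F) (∪⁅⁆-absorb c∈x))
            where
              c∈f′ : c ∈ f′
              c∈f′ = subst (c ∈_) (trans same′ y*≡f′)
                       (star-mono (∪-least (⊆-trans (p⊆p∪q f′) (p⊆p∪q _)) (q⊆p∪q _ _))
                         (star-new-point x c changed))
              c∈x : c ∈ x
              c∈x = subst (c ∈_) (step-skips changed) (took (∈-∪⁅⁆⁻ (f′⊆zb c∈f′) c≢b))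

  shift-run : ∀ {f′ b} → f′ ∈F F → ∀ L x → Unique L → All (_≢ b) L →
    star F (greedy x L ∪ ⁅ b ⁆) ≡ f′ → greedy (x ∪ f′) L ≡ greedy x L ∪ f′
  shift-run f′∈F [] x _ _ _ = refl
  shift-run {f′} f′∈F (c ∷ L) x (c∉L ∷ uL) (c≢b ∷ L≢b) zb*≡f′ = begin
    greedy (greedyStep c (x ∪ f′)) L  ≡⟨ cong (λ t → greedy t L) (shift-step f′∈F zb*≡f′ c≢b step⊆z took) ⟩
    greedy (greedyStep c x ∪ f′) L  ≡⟨ shift-run f′∈F L (greedyStep c x) uL L≢b zb*≡f′ ⟩
    greedy (greedyStep c x) L ∪ f′  ∎
    where
      open ≡-Reasoning
      step⊆z : greedyStep c x ⊆ greedy (greedyStep c x) L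
      step⊆z = greedy-⊇ (greedyStep c x) L
      -- c occurs only once in c ∷ L, so a later step cannot add it.
      took : c ∈ greedy (greedyStep c x) L → c ∈ greedyStep c x
      took c∈z with greedy-letters (greedyStep c x) L c∈z
      ... | inj₁ c∈step = c∈step
      ... | inj₂ c∈L = ⊥-elim (All¬⇒¬Any c∉L c∈L)

  open DecMem (≡-dec {n = n} BoolP._≟_) using (_∈?_)

  -- When b keeps the star, z ∪ {b} ∈ T forces z ∪ {b} = z; when it does not,
  -- the shift lemma exhibits z ∪ {b} as the run from (z ∪ {b})* ∈ F, so φ_{T,b} is blocked.
  rise-agrees : ∀ {T pre b f} → Image T pre → Unique pre → All (_≢ b) pre → f ∈F F →
    rise T b (greedy f pre) ≡ greedy f (pre ++ [ b ])
  rise-agrees {T} {pre} {b} {f} image unique-pre pre≢b f∈F =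
    trans (decide (star F (z ∪ ⁅ b ⁆) ≟ₛ star F z)) (sym (greedy-++ f pre [ b ]))
    where
      open ≡-Reasoning
      z : Subset n
      z = greedy f pre
      z*≡f : star F z ≡ f
      z*≡f = trans (greedy-star f pre) (star-fixes f∈F)
      decide : Dec (star F (z ∪ ⁅ b ⁆) ≡ star F z) → rise T b z ≡ greedyStep b z
      decide (yes same) = trans rise-takes (sym (step-adds same))
        where
          rise-takes : rise T b z ≡ z ∪ ⁅ b ⁆
          rise-takes = member ((z ∪ ⁅ b ⁆) ∈? T)
            where
              member : Dec ((z ∪ ⁅ b ⁆) ∈F T) → rise T b z ≡ z ∪ ⁅ b ⁆
              member (no z∪b∉T) = rise-free z∪b∉T
              member (yes z∪b∈T) = trans (rise-blocked z∪b∈T) (sym z∪b≡z)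
                where
                  z∪b≡z : z ∪ ⁅ b ⁆ ≡ z
                  z∪b≡z = trans (image-canonical {pre = pre} image z∪b∈T) (cong (λ t → greedy t pre) (trans same z*≡f))
      decide (no changed) = trans (rise-blocked z∪b∈T) (sym (step-skips changed))
        where
          f′ : Subset n
          f′ = star F (z ∪ ⁅ b ⁆)
          f′∈F : f′ ∈F F
          f′∈F = star-∈F UC f∈F (⊆-trans (greedy-⊇ f pre) (p⊆p∪q _))
          f⊆f′ : f ⊆ f′
          f⊆f′ = subst (_⊆ f′) z*≡f (star-mono (p⊆p∪q _))
          run : greedy f′ pre ≡ z ∪ ⁅ b ⁆
          run = begin
            greedy f′ pre  ≡⟨ cong (λ t → greedy t pre) (⊆-antisym (q⊆p∪q f f′) (∪-least f⊆f′ id)) ⟩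
            greedy (f ∪ f′) pre  ≡⟨ shift-run f′∈F pre f unique-pre pre≢b refl ⟩
            z ∪ f′  ≡⟨ ⊆-antisym (∪-least (p⊆p∪q _) (star-⊆ _))
                        (∪-least (p⊆p∪q _) (⁅⁆-⊆ (q⊆p∪q z f′ (star-new-point z b changed)))) ⟩
            z ∪ ⁅ b ⁆  ∎
          z∪b∈T : (z ∪ ⁅ b ⁆) ∈F T
          z∪b∈T = subst (_∈F T) run (proj₂ image f′ f′∈F)

  image-step : ∀ {T pre b} → Image T pre → Unique pre → All (_≢ b) pre →
    Image (map (rise T b) T) (pre ++ [ b ])
  image-step {T} {pre} {b} image unique-pre pre≢b = runs , runs-in
    where
      runs : ∀ w → w ∈F map (rise T b) T → ∃[ f ] (f ∈F F × w ≡ greedy f (pre ++ [ b ]))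
      runs w w∈ with ∈-map⁻ (rise T b) w∈
      ... | t , t∈T , refl with proj₁ image t t∈T
      ...   | f , f∈F , refl = f , f∈F , rise-agrees image unique-pre pre≢b f∈F
      runs-in : ∀ f → f ∈F F → greedy f (pre ++ [ b ]) ∈F map (rise T b) T
      runs-in f f∈F = subst (_∈F map (rise T b) T) (rise-agrees image unique-pre pre≢b f∈F)
                        (∈-map⁺ (rise T b) (proj₂ image f f∈F))

  phiAux-greedy : ∀ bs pre {T} → Unique (pre ++ bs) → Image T pre → ∀ {f} → f ∈F F →
    phiAux T bs (greedy f pre) ≡ greedy f (pre ++ bs)
  phiAux-greedy [] pre _ _ {f} _ = cong (greedy f) (sym (++-identityʳ pre))
  phiAux-greedy (b ∷ bs) pre {T} unique image {f} f∈F = begin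
    phiAux T′ bs (rise T b (greedy f pre))  ≡⟨ cong (phiAux T′ bs) (rise-agrees image unique-pre pre≢b f∈F) ⟩
    phiAux T′ bs (greedy f (pre ++ [ b ]))  ≡⟨ phiAux-greedy bs (pre ++ [ b ]) unique′
                                                 (image-step image unique-pre pre≢b) f∈F ⟩
    greedy f ((pre ++ [ b ]) ++ bs)  ≡⟨ cong (greedy f) (++-assoc pre [ b ] bs) ⟩
    greedy f (pre ++ b ∷ bs)  ∎
    where
      open ≡-Reasoning
      T′ : Family n
      T′ = map (rise T b) T
      unique-pre : Unique pre
      unique-pre = proj₁ (unique-split pre unique)
      pre≢b : All (_≢ b) pre
      pre≢b = proj₂ (unique-split pre unique)
      unique′ : Unique ((pre ++ [ b ]) ++ bs)
      unique′ = subst Unique (sym (++-assoc pre [ b ] bs)) unique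

  phi-greedy : ∀ {u g} → Unique u → g ∈F F → phi F u g ≡ greedy g u
  phi-greedy {u} unique = phiAux-greedy u [] unique ((λ w w∈F → w , w∈F , refl) , λ _ f∈F → f∈F)

-- Theorem 4.3.
theorem4p3 : (n : ℕ) → 1 ≤ n → (F : Family n) → UnionClosed F → Covers F →
    (g : Subset n) → g ∈F F →
    ∀ (z : Subset n) →
    (∃[ u ] ((u ↭ allFin n) × phi F u g ≡ z)) ⇔ InMaxFib F g z
theorem4p3 n _ F UC _ g g∈F z = mk⇔ realised reachable
  where
    open Closure F
    open Rising F UC
    duplicate-free : ∀ {u} → u ↭ allFin n → Unique u
    duplicate-free u↭ = unique-↭ (↭-sym u↭) (allFin⁺ n)
    realised : ∃[ u ] ((u ↭ allFin n) × phi F u g ≡ z) → InMaxFib F g z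
    realised (u , u↭ , φu≡z) =
      subst (InMaxFib F g) (trans (sym (phi-greedy (duplicate-free u↭) g∈F)) φu≡z)
        (greedy-maxFib g∈F λ a → ∈-resp-↭ (↭-sym u↭) (∈-allFin a))
    reachable : InMaxFib F g z → ∃[ u ] ((u ↭ allFin n) × phi F u g ≡ z)
    reachable z-max = u , u↭ , trans (phi-greedy (duplicate-free u↭) g∈F) (maxFib-reached g∈F z-max _)
      where
        u : List (Fin n)
        u = lettersOf z ++ filter (¬? ∘ (_∈ₛ? z)) (allFin n)
        u↭ : u ↭ allFin n
        u↭ = filter-split-↭ (_∈ₛ? z) (allFin n)
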